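{- Let $H$ be a digraph and let $P_1,P_2$ be one-way infinite walks in $H$ of infinite height that are constricted from below, with $P_i$ starting at $p_i$ ($i=1,2$). For $i=1,2$ let $q_i$ be a vertex occurrence on $P_i$ such that the infinite portion of $P_i$ starting at $q_i$ is also constricted from below, and such that the portions of $P_1$ from $p_1$ to $q_1$ and of $P_2$ from $p_2$ to $q_2$ have the same net length. Then there is a finite oriented path $P$ with homomorphisms $f_i$ of $P$ to $P_i$ ($i=1,2$) taking the starting vertex of $P$ to $p_i$ and the ending vertex of $P$ to $q_i$.
   Context: A (one-way infinite) walk $w_0,w_1,\dots$ is a sequence of vertices where each $w_jw_{j+1}$ is a designated forward arc ($w_jw_{j+1}\in A(H)$) or backward arc ($w_{j+1}w_j\in A(H)$); the net length of a finite walk is (#forward) $-$ (#backward). An infinite walk is constricted from below if no finite initial subwalk has negative net length, and has infinite height if the net lengths of its initial subwalks are unbounded. A homomorphism of an oriented path to a walk $W$ means a homomorphism to the oriented path $\hat W$ with vertex set the positions $0,1,2,\dots$ of $W$ and arc $j\to j+1$ if $w_jw_{j+1}$ is forward and $j+1\to j$ otherwise; "taking a vertex to $p_i$ (resp. $q_i$)" means to the position of $p_i$ (resp. of the specified occurrence $q_i$). -}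

module Defs where

open import Level using (Level; _⊔_) renaming (suc to lsuc)
open import Data.Bool using (Bool; true; false)
open import Data.Nat using (ℕ; zero; suc; _+_; _≤_)
open import Data.Fin using (Fin; inject₁; fromℕ) renaming (zero to fzero; suc to fsuc)
open import Data.Integer using (ℤ; +_; _-_; ∣_∣) renaming (_+_ to _ℤ+_; _≤_ to _ℤ≤_)
open import Data.Integer using () renaming (-_ to ℤ-)
open import Data.Product using (Σ; ∃; _×_)
open import Data.Sum using (_⊎_)
open import Relation.Binary.PropositionalEquality using (_≡_)

record Digraph (a b : Level) : Set (lsuc (a ⊔ b)) where
  field
    V   : Set a
    Arc : V → V → Set b

-- Direction of a step of a walk: true = forward arc, false = backward arc.
Dir : Set
Dir = Bool

record Walk {a b : Level} (H : Digraph a b) : Set (a ⊔ b) where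
  open Digraph H
  field
    vtx   : ℕ → V
    dir   : ℕ → Dir
    valid : ∀ j → (dir j ≡ true → Arc (vtx j) (vtx (suc j)))
                × (dir j ≡ false → Arc (vtx (suc j)) (vtx j))

step : Dir → ℤ
step true  = + 1
step false = ℤ- (+ 1)

-- net length of the initial subwalk w₀ … w_n (n steps)
netLen : (ℕ → Dir) → ℕ → ℤ
netLen d zero    = + 0
netLen d (suc n) = netLen d n ℤ+ step (d n)

-- the direction sequence of the infinite portion of a walk starting at position k
shift : ℕ → (ℕ → Dir) → (ℕ → Dir)
shift k d j = d (k + j)

ConstrictedBelow : (ℕ → Dir) → Set
ConstrictedBelow d = ∀ n → + 0 ℤ≤ netLen d n

InfiniteHeight : (ℕ → Dir) → Set
InfiniteHeight d = ∀ (B : ℕ) → ∃ λ n → B ≤ ∣ netLen d n ∣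

-- A finite oriented path with m arcs: vertices Fin (suc m) = 0 … m,
-- arc i → i+1 if dirs i = true, arc i+1 → i if dirs i = false.
PathArc : {m : ℕ} → (Fin m → Dir) → Fin (suc m) → Fin (suc m) → Set
PathArc {m} dirs x y =
  Σ (Fin m) λ i → (dirs i ≡ true × x ≡ inject₁ i × y ≡ fsuc i)
                ⊎ (dirs i ≡ false × x ≡ fsuc i × y ≡ inject₁ i)

-- The oriented path Ŵ of a walk with directions d: vertices ℕ (positions),
-- arc j → j+1 if step j is forward, arc j+1 → j if step j is backward.
WalkArc : (ℕ → Dir) → ℕ → ℕ → Set
WalkArc d x y = (d x ≡ true × y ≡ suc x) ⊎ (d y ≡ false × x ≡ suc y)

IsHom : {m : ℕ} → (Fin m → Dir) → (ℕ → Dir) → (Fin (suc m) → ℕ) → Set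
IsHom dirs d f = ∀ x y → PathArc dirs x y → WalkArc d (f x) (f y)

module Submission where

-- A walk with step directions d is encoded by its height profile
-- j ↦ netLen d |j| : ℤ → ℤ, whose neighbouring values differ by exactly one.  A joint
-- walk of two profiles is a sequence of position pairs in which both positions move
-- to a neighbour while both heights rise, or both fall, by one; it yields a finite
-- oriented path with homomorphisms to both walks (toPath).  The core is a discrete
-- mountain-climbing theorem (mountainClimb): two profiles climbing from level L to U,
-- never below L and reaching U only at the end, admit a joint walk between their
-- ends.  For the corollary, both walks
-- climb from p_i (position 0) to a level M above q_i, and also from q_i (position k_i,
-- at equal heights by hypothesis) to M; joining both at the first visits of M gives
-- the path (jointWalk).

open import Defs
open import Level using (Level)
open import Data.Bool using (Bool)
open import Data.Nat using (ℕ; suc)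
open import Data.Fin using (Fin; fromℕ) renaming (zero to fzero)
open import Data.Product using (Σ; _×_)
open import Relation.Binary.PropositionalEquality using (_≡_)

open import Data.Bool using (true; false)
open import Data.Nat as ℕ using (zero; z≤n; s≤s; s≤s⁻¹)
import Data.Nat.Properties as ℕP
open import Data.Integer
  using (ℤ; +_; -[1+_]; 0ℤ; 1ℤ; -1ℤ; _+_; _-_; -_; _≤_; _<_; ∣_∣; _≤?_; _≟_; pred; +≤+; -≤+)
  renaming (suc to sucℤ)
import Data.Integer.Properties as ℤP
open import Data.Integer.Tactic.RingSolver using (solve-∀)
open import Data.Fin using () renaming (suc to fsuc)
import Data.Vec.Functional as Vector
open import Data.Product using (_,_)
import Data.Product as Product
open import Data.Sum using (_⊎_; inj₁; inj₂; [_,_])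
import Data.Sum as Sum
open import Data.Empty using (⊥-elim)
open import Function using (_∘_)
open import Relation.Nullary using (¬_; Dec; yes; no)
open import Relation.Binary.PropositionalEquality
  using (_≢_; refl; sym; trans; cong; cong₂; subst; subst₂; module ≡-Reasoning)

-- Height profiles

Rises : (ℤ → ℤ) → ℤ → ℤ → Set
Rises g p q = g q ≡ sucℤ (g p)

Adjacent : ℤ → ℤ → Set
Adjacent p q = q ≡ sucℤ p ⊎ p ≡ sucℤ q

adjacent-sym : ∀ {p q} → Adjacent p q → Adjacent q p
adjacent-sym = Sum.swap

UnitSteps : (ℤ → ℤ) → Set
UnitSteps g = ∀ j → Rises g j (sucℤ j) ⊎ Rises g (sucℤ j) j

risesOrFalls : ∀ {g} → UnitSteps g → ∀ {p q} → Adjacent p q → Rises g p q ⊎ Rises g q p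
risesOrFalls steps {p}     (inj₁ refl) = steps p
risesOrFalls steps {q = q} (inj₂ refl) = Sum.swap (steps q)

stepAtMostOne : ∀ {g} → UnitSteps g → ∀ j → g (sucℤ j) ≤ sucℤ (g j)
stepAtMostOne steps j with steps j
... | inj₁ rise = ℤP.≤-reflexive rise
... | inj₂ fall =
  ℤP.≤-trans (ℤP.i≤suc[i] _) (ℤP.≤-trans (ℤP.≤-reflexive (sym fall)) (ℤP.i≤suc[i] _))

PreservesAdjacency : (ℤ → ℤ) → Set
PreservesAdjacency φ = ∀ {p q} → Adjacent p q → Adjacent (φ p) (φ q)

translation : ∀ c → PreservesAdjacency (_+ c)
translation c {p}     (inj₁ refl) = inj₁ (ℤP.+-assoc 1ℤ p c)
translation c {q = q} (inj₂ refl) = inj₂ (ℤP.+-assoc 1ℤ q c)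

reflect-suc : ∀ c p → c - p ≡ 1ℤ + (c - (1ℤ + p))
reflect-suc = solve-∀

reflection : ∀ c → PreservesAdjacency (λ j → c - j)
reflection c {p}     (inj₁ refl) = inj₂ (reflect-suc c p)
reflection c {q = q} (inj₂ refl) = inj₁ (reflect-suc c q)

unitSteps-∘ : ∀ {g} → UnitSteps g → ∀ {φ} → PreservesAdjacency φ → UnitSteps (g ∘ φ)
unitSteps-∘ steps adj j = risesOrFalls steps (adj (inj₁ refl))

neg-rise : ∀ {x y} → y ≡ sucℤ x → - x ≡ sucℤ (- y)
neg-rise {x} refl = neg-suc x
  where
  neg-suc : ∀ x → - x ≡ 1ℤ + - (1ℤ + x)
  neg-suc = solve-∀

neg-rise⁻¹ : ∀ {x y} → - y ≡ sucℤ (- x) → x ≡ sucℤ y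
neg-rise⁻¹ {x} {y} e =
  subst₂ (λ a b → a ≡ sucℤ b) (ℤP.neg-involutive x) (ℤP.neg-involutive y) (neg-rise e)

unitSteps-neg : ∀ {g} → UnitSteps g → UnitSteps (λ j → - g j)
unitSteps-neg steps j = Sum.swap (Sum.map neg-rise neg-rise (steps j))

shiftBy : ℕ → (ℤ → ℤ) → ℤ → ℤ
shiftBy c g j = g (j + + c)

reflectAt : ℕ → (ℤ → ℤ) → ℤ → ℤ
reflectAt c g j = g (+ c - j)

reflect-pos : ∀ {n t} → t ℕ.≤ n → + n - + t ≡ + (n ℕ.∸ t)
reflect-pos {n} {t} t≤n = trans (ℤP.m-n≡m⊖n n t) (ℤP.⊖-≥ t≤n)

-- Joint walks

JointStep : (g₁ g₂ : ℤ → ℤ) (a b a' b' : ℤ) → Set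
JointStep g₁ g₂ a b a' b' =
  Adjacent a a' × Adjacent b b' × (Rises g₁ a a' × Rises g₂ b b' ⊎ Rises g₁ a' a × Rises g₂ b' b)

infixr 5 _∷_
data Joint (g₁ g₂ : ℤ → ℤ) : ℤ → ℤ → ℤ → ℤ → Set where
  []  : ∀ {a b} → Joint g₁ g₂ a b a b
  _∷_ : ∀ {a b a' b' a'' b''} →
        JointStep g₁ g₂ a b a' b' → Joint g₁ g₂ a' b' a'' b'' → Joint g₁ g₂ a b a'' b''

module _ {g₁ g₂ : ℤ → ℤ} where

  infixr 5 _++_
  _++_ : ∀ {a b a' b' a'' b''} →
         Joint g₁ g₂ a b a' b' → Joint g₁ g₂ a' b' a'' b'' → Joint g₁ g₂ a b a'' b''
  []      ++ r = r
  (s ∷ r) ++ r' = s ∷ (r ++ r')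

  reverse : ∀ {a b a' b'} → Joint g₁ g₂ a b a' b' → Joint g₁ g₂ a' b' a b
  reverse [] = []
  reverse ((adj₁ , adj₂ , rises) ∷ r) =
    reverse r ++ ((adjacent-sym adj₁ , adjacent-sym adj₂ , Sum.swap rises) ∷ [])

  swapJoint : ∀ {a b a' b'} → Joint g₁ g₂ a b a' b' → Joint g₂ g₁ b a b' a'
  swapJoint [] = []
  swapJoint ((adj₁ , adj₂ , rises) ∷ r) =
    (adj₂ , adj₁ , Sum.map Product.swap Product.swap rises) ∷ swapJoint r

  castJoint : ∀ {a b a' b' x y x' y'} → a ≡ x → b ≡ y → a' ≡ x' → b' ≡ y' →
              Joint g₁ g₂ a b a' b' → Joint g₁ g₂ x y x' y'
  castJoint refl refl refl refl r = r

mapJoint : ∀ {g₁ g₂ h₁ h₂ : ℤ → ℤ} (φ₁ φ₂ : ℤ → ℤ) →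
  (∀ {a b a' b'} → JointStep g₁ g₂ a b a' b' → JointStep h₁ h₂ (φ₁ a) (φ₂ b) (φ₁ a') (φ₂ b')) →
  ∀ {a b a' b'} → Joint g₁ g₂ a b a' b' → Joint h₁ h₂ (φ₁ a) (φ₂ b) (φ₁ a') (φ₂ b')
mapJoint φ₁ φ₂ f [] = []
mapJoint φ₁ φ₂ f (s ∷ r) = f s ∷ mapJoint φ₁ φ₂ f r

pullback : ∀ {g₁ g₂} (φ₁ φ₂ : ℤ → ℤ) → PreservesAdjacency φ₁ → PreservesAdjacency φ₂ →
  ∀ {a b a' b'} → Joint (g₁ ∘ φ₁) (g₂ ∘ φ₂) a b a' b' → Joint g₁ g₂ (φ₁ a) (φ₂ b) (φ₁ a') (φ₂ b')
pullback φ₁ φ₂ adj₁ adj₂ = mapJoint φ₁ φ₂ λ (x , y , rises) → adj₁ x , adj₂ y , rises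

unnegate : ∀ {g₁ g₂ a b a' b'} →
  Joint (λ j → - g₁ j) (λ j → - g₂ j) a b a' b' → Joint g₁ g₂ a b a' b'
unnegate = mapJoint (λ j → j) (λ j → j) λ (x , y , rises) →
  x , y , Sum.swap (Sum.map (Product.map neg-rise⁻¹ neg-rise⁻¹)
                             (Product.map neg-rise⁻¹ neg-rise⁻¹) rises)

unshift : ∀ {g₁ g₂ c₁ c₂ n₁ n₂} → c₁ ℕ.≤ n₁ → c₂ ℕ.≤ n₂ →
  Joint (shiftBy c₁ g₁) (shiftBy c₂ g₂) 0ℤ 0ℤ (+ (n₁ ℕ.∸ c₁)) (+ (n₂ ℕ.∸ c₂)) →
  Joint g₁ g₂ (+ c₁) (+ c₂) (+ n₁) (+ n₂)
unshift {c₁ = c₁} {c₂} c₁≤n₁ c₂≤n₂ r =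
  castJoint refl refl (cong +_ (ℕP.m∸n+n≡m c₁≤n₁)) (cong +_ (ℕP.m∸n+n≡m c₂≤n₂))
    (pullback (_+ + c₁) (_+ + c₂) (translation _) (translation _) r)

≤-suc-cases : ∀ {s n} → s ℕ.≤ suc n → s ℕ.≤ n ⊎ s ≡ suc n
≤-suc-cases s≤1+n = Sum.map₁ s≤s⁻¹ (ℕP.m≤n⇒m<n∨m≡n s≤1+n)

module Search {P : ℕ → Set} (P? : ∀ t → Dec (P t)) where

  scan : ∀ n → (Σ ℕ λ t → t ℕ.≤ n × P t × (∀ s → s ℕ.< t → ¬ P s)) ⊎ (∀ s → s ℕ.≤ n → ¬ P s)
  scan zero with P? zero
  ... | yes p = inj₁ (0 , z≤n , p , λ _ ())
  ... | no ¬p = inj₂ λ { zero _ → ¬p }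
  scan (suc n) with scan n | P? (suc n)
  ... | inj₁ (t , t≤n , p , before) | _ = inj₁ (t , ℕP.m≤n⇒m≤1+n t≤n , p , before)
  ... | inj₂ none | yes p = inj₁ (suc n , ℕP.≤-refl , p , λ s s<1+n → none s (s≤s⁻¹ s<1+n))
  ... | inj₂ none | no ¬p = inj₂ λ s s≤1+n → [ none s , (λ { refl → ¬p }) ] (≤-suc-cases s≤1+n)

  least : ∀ {n} → P n → Σ ℕ λ t → t ℕ.≤ n × P t × (∀ s → s ℕ.< t → ¬ P s)
  least {n} p with scan n
  ... | inj₁ found = found
  ... | inj₂ none  = ⊥-elim (none n ℕP.≤-refl p)

  greatest : ∀ n {k} → k ℕ.≤ n → P k →
             Σ ℕ λ t → t ℕ.≤ n × P t × (∀ s → t ℕ.< s → s ℕ.≤ n → ¬ P s)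
  greatest n k≤n pk with P? n
  ... | yes pn = n , ℕP.≤-refl , pn , λ s n<s s≤n → ⊥-elim (ℕP.<⇒≱ n<s s≤n)
  greatest zero z≤n pk | no ¬pn = ⊥-elim (¬pn pk)
  greatest (suc n) k≤1+n pk | no ¬pn with ≤-suc-cases k≤1+n
  ... | inj₂ refl = ⊥-elim (¬pn pk)
  ... | inj₁ k≤n with greatest n k≤n pk
  ...   | t , t≤n , pt , after =
    t , ℕP.m≤n⇒m≤1+n t≤n , pt ,
    λ s t<s s≤1+n → [ after s t<s , (λ { refl → ¬pn }) ] (≤-suc-cases s≤1+n)

argmax : (f : ℕ → ℤ) → ∀ n → Σ ℕ λ w → w ℕ.≤ n × (∀ t → t ℕ.≤ n → f t ≤ f w)
argmax f zero = 0 , z≤n , λ { zero z≤n → ℤP.≤-refl }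
argmax f (suc n) with argmax f n
... | w , w≤n , max with f (suc n) ≤? f w
...   | yes last≤ =
  w , ℕP.m≤n⇒m≤1+n w≤n , λ t t≤1+n → [ max t , (λ { refl → last≤ }) ] (≤-suc-cases t≤1+n)
...   | no last≰ =
  suc n , ℕP.≤-refl , λ t t≤1+n →
    [ (λ t≤n → ℤP.≤-trans (max t t≤n) (ℤP.<⇒≤ (ℤP.≰⇒> last≰))) , (λ { refl → ℤP.≤-refl }) ]
    (≤-suc-cases t≤1+n)

-- Climbs, excursions and ascents of a profile, all starting at position 0

record Climb (g : ℤ → ℤ) (L U : ℤ) (n : ℕ) : Set where
  field
    start : g 0ℤ ≡ L
    end   : g (+ n) ≡ U
    above : ∀ t → t ℕ.≤ n → L ≤ g (+ t)
    below : ∀ t → t ℕ.< n → g (+ t) < U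

record Excursion (g : ℤ → ℤ) (L C : ℤ) (n : ℕ) : Set where
  field
    start  : g 0ℤ ≡ L
    end    : g (+ n) ≡ L
    above  : ∀ t → t ℕ.≤ n → L ≤ g (+ t)
    capped : ∀ t → t ℕ.≤ n → g (+ t) ≤ C

record Ascent (g : ℤ → ℤ) (L C : ℤ) (p : ℕ) : Set where
  field
    start : g 0ℤ ≡ L
    above : ∀ t → t ℕ.≤ p → L ≤ g (+ t)
    top   : C ≤ g (+ p)

open Climb
open Excursion
open Ascent

emptyClimb : ∀ {g L U} → Climb g L U 0 → L ≡ U
emptyClimb c = trans (sym (start c)) (end c)

properClimb : ∀ {g L U n} → Climb g L U (suc n) → L < U
properClimb c = subst (_< _) (start c) (below c 0 (s≤s z≤n))

climbCapped : ∀ {g L U n} → Climb g L U n → ∀ t → t ℕ.≤ n → g (+ t) ≤ U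
climbCapped c t t≤n with ℕP.m≤n⇒m<n∨m≡n t≤n
... | inj₁ t<n  = ℤP.<⇒≤ (below c t t<n)
... | inj₂ refl = ℤP.≤-reflexive (end c)

climbAscent : ∀ {g L U C n} → Climb g L U n → C ≤ U → Ascent g L C n
climbAscent c C≤U = record
  { start = start c ; above = above c ; top = subst (_ ≤_) (sym (end c)) C≤U }

climbPrefix : ∀ {g L U n z} → Climb g L U n → z ℕ.< n → g (+ z) ≡ L → Excursion g L (pred U) z
climbPrefix c z<n atZ = record
  { start  = start c
  ; end    = atZ
  ; above  = λ t t≤z → above c t (ℕP.≤-trans t≤z (ℕP.<⇒≤ z<n))
  ; capped = λ t t≤z → ℤP.i<j⇒i≤pred[j] (below c t (ℕP.≤-<-trans t≤z z<n))
  }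

climbSuffix : ∀ {g L L' U n z} → Climb g L U n → z ℕ.≤ n → g (+ z) ≡ L' →
  (∀ s → z ℕ.≤ s → s ℕ.≤ n → L' ≤ g (+ s)) → Climb (shiftBy z g) L' U (n ℕ.∸ z)
climbSuffix {g} {n = n} {z} c z≤len atZ high = record
  { start = atZ
  ; end   = trans (cong (g ∘ +_) (ℕP.m∸n+n≡m z≤len)) (end c)
  ; above = λ t t≤ → high (t ℕ.+ z) (ℕP.m≤n+m z t) (inside t≤)
  ; below = λ t t< → below c (t ℕ.+ z) (inside t<)
  }
  where
  inside : ∀ {t} → t ℕ.≤ n ℕ.∸ z → t ℕ.+ z ℕ.≤ n
  inside = ℕP.m≤o∸n⇒m+n≤o _ z≤len

firstClimb : ∀ {g L C p v} → UnitSteps g → Ascent g L C p → L ≤ v → v ≤ C →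
  Σ ℕ λ τ → τ ℕ.≤ p × Climb g L v τ
firstClimb {g} {v = v} steps asc L≤v v≤C
  with Search.least (λ t → v ≤? g (+ t)) (ℤP.≤-trans v≤C (top asc))
... | τ , τ≤p , v≤gτ , before = τ , τ≤p , record
  { start = start asc
  ; end   = ℤP.≤-antisym (notAbove τ before) v≤gτ
  ; above = λ t t≤τ → above asc t (ℕP.≤-trans t≤τ τ≤p)
  ; below = λ t t<τ → ℤP.≰⇒> (before t t<τ)
  }
  where
  notAbove : ∀ τ → (∀ s → s ℕ.< τ → ¬ v ≤ g (+ s)) → g (+ τ) ≤ v
  notAbove zero    _      = subst (_≤ v) (sym (start asc)) L≤v
  notAbove (suc s) before =
    ℤP.≤-trans (stepAtMostOne steps (+ s)) (ℤP.i<j⇒suc[i]≤j (ℤP.≰⇒> (before s ℕP.≤-refl)))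

record LastVisit (g : ℤ → ℤ) (L : ℤ) (n : ℕ) : Set where
  field
    z          : ℕ
    z<n        : z ℕ.< n
    atL        : g (+ z) ≡ L
    rises      : g (+ suc z) ≡ sucℤ L
    afterwards : ∀ s → z ℕ.< s → s ℕ.≤ n → L < g (+ s)

lastVisit : ∀ {g L U n} → UnitSteps g → Climb g L U (suc n) → LastVisit g L (suc n)
lastVisit {g} {L} {n = n} steps c
  with Search.greatest (λ t → g (+ t) ≟ L) (suc n) z≤n (start c)
... | z , z≤len , atL , later = record
  { z = z ; z<n = z<n ; atL = atL ; rises = rises ; afterwards = afterwards }
  where
  z<n : z ℕ.< suc n
  z<n = ℕP.≤∧≢⇒< z≤len λ { refl → ℤP.<-irrefl (trans (sym atL) (end c)) (properClimb c) }
  afterwards : ∀ s → z ℕ.< s → s ℕ.≤ suc n → L < g (+ s)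
  afterwards s z<s s≤n = ℤP.≤∧≢⇒< (above c s s≤n) (λ L≡gs → later s z<s s≤n (sym L≡gs))
  rises : g (+ suc z) ≡ sucℤ L
  rises = ℤP.≤-antisym (subst (λ x → g (+ suc z) ≤ sucℤ x) atL (stepAtMostOne steps (+ z)))
                       (ℤP.i<j⇒suc[i]≤j (afterwards (suc z) ℕP.≤-refl z<n))

tailClimb : ∀ {g L U n} → Climb g L U n → (v : LastVisit g L n) →
  Climb (shiftBy (suc (LastVisit.z v)) g) (sucℤ L) U (n ℕ.∸ suc (LastVisit.z v))
tailClimb c v = climbSuffix c z<n rises λ s z<s s≤n → ℤP.i<j⇒suc[i]≤j (afterwards s z<s s≤n)
  where open LastVisit v

bothRise : ∀ {g₁ g₂ L n₁ n₂} (v₁ : LastVisit g₁ L n₁) (v₂ : LastVisit g₂ L n₂) →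
  JointStep g₁ g₂ (+ LastVisit.z v₁) (+ LastVisit.z v₂)
                  (+ suc (LastVisit.z v₁)) (+ suc (LastVisit.z v₂))
bothRise v₁ v₂ = inj₁ refl , inj₁ refl , inj₁ (rise v₁ , rise v₂)
  where
  rise : ∀ {g L n} (v : LastVisit g L n) → Rises g (+ LastVisit.z v) (+ suc (LastVisit.z v))
  rise v = trans rises (cong sucℤ (sym atL)) where open LastVisit v

record Peak (g : ℤ → ℤ) (L : ℤ) (n : ℕ) : Set where
  field
    h       : ℤ
    e ℓ     : ℕ
    e≤ℓ     : e ℕ.≤ ℓ
    ℓ<n     : ℓ ℕ.< n
    atE     : g (+ e) ≡ h
    atℓ     : g (+ ℓ) ≡ h
    highest : ∀ t → t ℕ.≤ n → g (+ t) ≤ h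
    beforeE : ∀ t → t ℕ.< e → g (+ t) ≢ h
    afterℓ  : ∀ t → ℓ ℕ.< t → t ℕ.≤ n → g (+ t) ≢ h
    L<h     : L < h

excursionRises : ∀ {g L C n} → UnitSteps g → Excursion g L C (suc n) → g (+ 1) ≡ sucℤ L
excursionRises steps ex with steps 0ℤ
... | inj₁ rise = trans rise (cong sucℤ (start ex))
... | inj₂ fall =
  ⊥-elim (ℤP.<-irrefl refl (ℤP.<-≤-trans g₁<g₀ (subst (_≤ _) (sym (start ex)) g₀≤g₁)))
  where
  g₀≤g₁ = above ex 1 (s≤s z≤n)
  g₁<g₀ = ℤP.suc[i]≤j⇒i<j (ℤP.≤-reflexive (sym fall))

peak : ∀ {g L C n} → UnitSteps g → Excursion g L C (suc n) → Peak g L (suc n)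
peak {g} {L} {n = n} steps ex with argmax (g ∘ +_) (suc n)
... | w , w≤n , highest
  with Search.least (λ t → g (+ t) ≟ g (+ w)) refl
     | Search.greatest (λ t → g (+ t) ≟ g (+ w)) (suc n) w≤n refl
... | e , _ , atE , beforeE | ℓ , ℓ≤n , atℓ , afterℓ = record
  { h = g (+ w) ; e = e ; ℓ = ℓ ; e≤ℓ = e≤ℓ ; ℓ<n = ℓ<n ; atE = atE ; atℓ = atℓ
  ; highest = highest ; beforeE = beforeE ; afterℓ = afterℓ ; L<h = L<h }
  where
  e≤ℓ : e ℕ.≤ ℓ
  e≤ℓ = ℕP.≮⇒≥ λ ℓ<e → beforeE ℓ ℓ<e atℓ
  L<h : L < g (+ w)
  L<h = ℤP.suc[i]≤j⇒i<j (subst (_≤ _) (excursionRises steps ex) (highest 1 (s≤s z≤n)))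
  ℓ<n : ℓ ℕ.< suc n
  ℓ<n = ℕP.≤∧≢⇒< ℓ≤n λ { refl → ℤP.<-irrefl (trans (sym (end ex)) atℓ) L<h }

module _ {g L C n} (ex : Excursion g L C n) (pk : Peak g L n) where
  open Peak pk

  peakCapped : h ≤ C
  peakCapped = subst (_≤ C) atE (capped ex e (ℕP.≤-trans e≤ℓ (ℕP.<⇒≤ ℓ<n)))

  risingPart : Climb g L h e
  risingPart = record
    { start = start ex
    ; end   = atE
    ; above = λ t t≤e → above ex t (ℕP.≤-trans t≤e e≤n)
    ; below = λ t t<e → ℤP.≤∧≢⇒< (highest t (ℕP.≤-trans (ℕP.<⇒≤ t<e) e≤n)) (beforeE t t<e)
    }
    where
    e≤n = ℕP.≤-trans e≤ℓ (ℕP.<⇒≤ ℓ<n)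

  fallingPart : Climb (reflectAt n g) L h (n ℕ.∸ ℓ)
  fallingPart = record
    { start = trans (backwards z≤n) (end ex)
    ; end   = trans (backwards (ℕP.m∸n≤m n ℓ))
                    (trans (cong (g ∘ +_) (ℕP.m∸[m∸n]≡n (ℕP.<⇒≤ ℓ<n))) atℓ)
    ; above = λ t t≤ → subst (L ≤_) (sym (backwards (within t≤))) (above ex _ (ℕP.m∸n≤m n t))
    ; below = λ t t< → subst (_< h) (sym (backwards (within (ℕP.<⇒≤ t<))))
        (ℤP.≤∧≢⇒< (highest _ (ℕP.m∸n≤m n t)) (afterℓ _ (pastPeak t<) (ℕP.m∸n≤m n t)))
    }
    where
    backwards : ∀ {t} → t ℕ.≤ n → reflectAt n g (+ t) ≡ g (+ (n ℕ.∸ t))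
    backwards t≤n = cong g (reflect-pos t≤n)
    within : ∀ {t} → t ℕ.≤ n ℕ.∸ ℓ → t ℕ.≤ n
    within t≤ = ℕP.≤-trans t≤ (ℕP.m∸n≤m n ℓ)
    pastPeak : ∀ {t} → t ℕ.< n ℕ.∸ ℓ → ℓ ℕ.< n ℕ.∸ t
    pastPeak t< = subst (ℕ._< _) (ℕP.m∸[m∸n]≡n (ℕP.<⇒≤ ℓ<n)) (ℕP.∸-monoʳ-< t< (ℕP.m∸n≤m n ℓ))

  -- Between the first and the last visit of the peak, the mirrored excursion is an
  -- excursion from -h within [-h, -L]; it is strictly shorter than the original.
  plateauPart : Excursion (λ j → - shiftBy e g j) (- h) (- L) (ℓ ℕ.∸ e)
  plateauPart = record
    { start  = cong -_ atE
    ; end    = cong -_ (trans (cong (g ∘ +_) (ℕP.m∸n+n≡m e≤ℓ)) atℓ)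
    ; above  = λ t t≤ → ℤP.neg-mono-≤ (highest _ (inside t≤))
    ; capped = λ t t≤ → ℤP.neg-mono-≤ (above ex _ (inside t≤))
    }
    where
    inside : ∀ {t} → t ℕ.≤ ℓ ℕ.∸ e → t ℕ.+ e ℕ.≤ n
    inside t≤ = ℕP.≤-trans (ℕP.m≤o∸n⇒m+n≤o _ e≤ℓ t≤) (ℕP.<⇒≤ ℓ<n)

mirroredAscent : ∀ {g L U τ} → Climb g L U τ → Ascent (λ j → - reflectAt τ g j) (- U) (- L) τ
mirroredAscent {g} {L} {U} {τ} c = record
  { start = cong -_ (trans (cong g (reflect-pos z≤n)) (end c))
  ; above = λ t t≤τ → ℤP.neg-mono-≤ (subst (_≤ U) (sym (cong g (reflect-pos t≤τ)))
                                         (climbCapped c _ (ℕP.m∸n≤m τ t)))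
  ; top   = ℤP.≤-reflexive (cong -_ (sym (trans (cong g atStart) (start c))))
  }
  where
  atStart : + τ - + τ ≡ 0ℤ
  atStart = trans (reflect-pos (ℕP.≤-refl {τ})) (cong +_ (ℕP.n∸n≡0 τ))

-- The mountain-climbing theorem

fuel-pred : ∀ {L U} N → U ≤ L + + suc N → pred U ≤ L + + N
fuel-pred {L} {U} N fuel = subst (pred U ≤_) (shift-pred L (+ N)) (ℤP.+-monoʳ-≤ -1ℤ fuel)
  where
  shift-pred : ∀ L x → -1ℤ + (L + (1ℤ + x)) ≡ L + x
  shift-pred = solve-∀

fuel-suc : ∀ {L U} N → U ≤ L + + suc N → U ≤ sucℤ L + + N
fuel-suc {L} N = subst (_ ≤_) (shift-suc L (+ N))
  where
  shift-suc : ∀ L x → L + (1ℤ + x) ≡ (1ℤ + L) + x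
  shift-suc = solve-∀

fuel-neg : ∀ {L h} N → h ≤ L + + N → - L ≤ - h + + N
fuel-neg {L} {h} N fuel =
  subst₂ _≤_ (cancel-h h L) (cancel-L h L (+ N)) (ℤP.+-monoʳ-≤ (- h + - L) fuel)
  where
  cancel-h : ∀ h L → (- h + - L) + h ≡ - L
  cancel-h = solve-∀
  cancel-L : ∀ h L x → (- h + - L) + (L + x) ≡ - h + x
  cancel-L = solve-∀

fuel-none : ∀ {L U} → U ≤ L + + 0 → ¬ L < U
fuel-none {L} fuel L<U = ℤP.<-irrefl refl (ℤP.<-≤-trans L<U (subst (_ ≤_) (ℤP.+-identityʳ L) fuel))

ClimbLemma : ℕ → Set
ClimbLemma N = ∀ {g₁ g₂ L U n₁ n₂} → UnitSteps g₁ → UnitSteps g₂ → U ≤ L + + N →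
  Climb g₁ L U n₁ → Climb g₂ L U n₂ → Joint g₁ g₂ 0ℤ 0ℤ (+ n₁) (+ n₂)

ProperClimbLemma : ℕ → Set
ProperClimbLemma N = ∀ {g₁ g₂ L U n₁ n₂} → UnitSteps g₁ → UnitSteps g₂ → U ≤ L + + N →
  Climb g₁ L U (suc n₁) → Climb g₂ L U (suc n₂) → Joint g₁ g₂ 0ℤ 0ℤ (+ suc n₁) (+ suc n₂)

-- An excursion of length at most m within [L, C], with C ≤ L + N, can be traversed
-- while the partner profile, ascending to C, leaves position 0 and comes back.
ExcursionLemma : ℕ → ℕ → Set
ExcursionLemma N m = ∀ {g₁ g₂ L C n p} → UnitSteps g₁ → UnitSteps g₂ → C ≤ L + + N →
  n ℕ.≤ m → Excursion g₁ L C n → Ascent g₂ L C p → Joint g₁ g₂ 0ℤ 0ℤ (+ n) 0ℤ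

-- A climb of length 0 is flat, one of positive length is not: lengths vanish together.
fromProper : ∀ {N} → ProperClimbLemma N → ClimbLemma N
fromProper proper {n₁ = zero}  {zero}  _ _ _ _ _ = []
fromProper proper {n₁ = zero}  {suc _} _ _ _ c₁ c₂ =
  ⊥-elim (ℤP.<-irrefl (emptyClimb c₁) (properClimb c₂))
fromProper proper {n₁ = suc _} {zero}  _ _ _ c₁ c₂ =
  ⊥-elim (ℤP.<-irrefl (emptyClimb c₂) (properClimb c₁))
fromProper proper {n₁ = suc _} {suc _} = proper

-- Both climbs can be brought from their starts to their last bottom visits: first
-- the first climb performs its excursion below U, then the second one does.
toLastVisits : ∀ {N g₁ g₂ L U n₁ n₂} → (∀ m → ExcursionLemma N m) →
  UnitSteps g₁ → UnitSteps g₂ → pred U ≤ L + + N →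
  (c₁ : Climb g₁ L U n₁) (c₂ : Climb g₂ L U n₂)
  (v₁ : LastVisit g₁ L n₁) (v₂ : LastVisit g₂ L n₂) →
  Joint g₁ g₂ 0ℤ 0ℤ (+ LastVisit.z v₁) (+ LastVisit.z v₂)
toLastVisits excursion steps₁ steps₂ fuel c₁ c₂ v₁ v₂ =
  firstExcursion
  ++ pullback (_+ + z₁) (λ j → j) (translation _) (λ adj → adj) (swapJoint secondExcursion)
  where
  open LastVisit v₁ using () renaming (z to z₁; z<n to z₁<n₁; atL to atL₁)
  open LastVisit v₂ using () renaming (z<n to z₂<n₂; atL to atL₂)
  predU≤U = ℤP.i≤j⇒pred[i]≤j ℤP.≤-refl
  firstExcursion = excursion _ steps₁ steps₂ fuel ℕP.≤-refl
    (climbPrefix c₁ z₁<n₁ atL₁) (climbAscent c₂ predU≤U)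
  secondExcursion = excursion _ steps₂ (unitSteps-∘ steps₁ (translation _)) fuel ℕP.≤-refl
    (climbPrefix c₂ z₂<n₂ atL₂)
    (climbAscent (climbSuffix c₁ (ℕP.<⇒≤ z₁<n₁) atL₁ (λ s _ s≤n₁ → above c₁ s s≤n₁)) predU≤U)

-- Inductive step in the height: reach the last bottom visits, rise together, and
-- climb the remaining height U - (L + 1) by induction.
climbStep : ∀ {N} → (∀ m → ExcursionLemma N m) → ClimbLemma N → ClimbLemma (suc N)
climbStep {N} excursion climb = fromProper λ {L = L} steps₁ steps₂ fuel c₁ c₂ →
  let v₁ = lastVisit steps₁ c₁
      v₂ = lastVisit steps₂ c₂
  in toLastVisits excursion steps₁ steps₂ (fuel-pred {L} N fuel) c₁ c₂ v₁ v₂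
     ++ bothRise v₁ v₂
     ∷ unshift (LastVisit.z<n v₁) (LastVisit.z<n v₂)
         (climb (unitSteps-∘ steps₁ (translation _)) (unitSteps-∘ steps₂ (translation _))
                (fuel-suc {L} N fuel) (tailClimb c₁ v₁) (tailClimb c₂ v₂))

-- Inductive step in the length: the first profile climbs to its peak h while the
-- partner climbs to its first visit of h; the plateau between the first and last
-- visits of h is a shorter mirrored excursion; the descent from the peak is the
-- reversal of a climb.
excursionStep : ∀ {N m} → ClimbLemma N → ExcursionLemma N m → ExcursionLemma N (suc m)
excursionStep climb excursion {n = zero} _ _ _ _ _ _ = []
excursionStep {N} climb excursion {g₁} {g₂} {L} {n = suc n} steps₁ steps₂ fuel n≤m ex asc
  with peak steps₁ ex
... | pk with firstClimb steps₂ asc (ℤP.<⇒≤ (Peak.L<h pk)) (peakCapped ex pk)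
...   | τ , _ , partner = up ++ across ++ reverse down
  where
  open Peak pk
  fuelh : h ≤ L + + N
  fuelh = ℤP.≤-trans (peakCapped ex pk) fuel
  up : Joint g₁ g₂ 0ℤ 0ℤ (+ e) (+ τ)
  up = climb steps₁ steps₂ fuelh (risingPart ex pk) partner
  across : Joint g₁ g₂ (+ e) (+ τ) (+ ℓ) (+ τ)
  across = castJoint refl (reflect-pos z≤n) (cong +_ (ℕP.m∸n+n≡m e≤ℓ)) (reflect-pos z≤n)
    (pullback (_+ + e) (λ j → + τ - j) (translation _) (reflection (+ τ))
      (unnegate (excursion (unitSteps-neg (unitSteps-∘ steps₁ (translation _)))
                           (unitSteps-neg (unitSteps-∘ steps₂ (reflection (+ τ))))
                           (fuel-neg N fuelh) plateauShorter (plateauPart ex pk)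
                           (mirroredAscent partner))))
    where
    plateauShorter : ℓ ℕ.∸ e ℕ.≤ _
    plateauShorter = s≤s⁻¹ (ℕP.<-≤-trans (ℕP.≤-<-trans (ℕP.m∸n≤m ℓ e) ℓ<n) n≤m)
  down : Joint g₁ g₂ (+ suc n) 0ℤ (+ ℓ) (+ τ)
  down = castJoint (reflect-pos z≤n) refl
    (trans (reflect-pos (ℕP.m∸n≤m (suc n) ℓ)) (cong +_ (ℕP.m∸[m∸n]≡n (ℕP.<⇒≤ ℓ<n)))) refl
    (pullback (λ j → + suc n - j) (λ j → j) (reflection (+ suc n)) (λ adj → adj)
      (climb (unitSteps-∘ steps₁ (reflection (+ suc n))) steps₂ fuelh (fallingPart ex pk) partner))

mutual
  mountainClimb : ∀ N → ClimbLemma N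
  mountainClimb zero    = fromProper λ _ _ fuel c₁ _ → ⊥-elim (fuel-none fuel (properClimb c₁))
  mountainClimb (suc N) = climbStep (excursionLemma N) (mountainClimb N)

  excursionLemma : ∀ N m → ExcursionLemma N m
  excursionLemma N zero _ _ _ z≤n _ _ = []
  excursionLemma N (suc m) = excursionStep (mountainClimb N) (excursionLemma N m)

-- Walks as profiles

profile : (ℕ → Dir) → ℤ → ℤ
profile d j = netLen d ∣ j ∣

step-as-difference : ∀ a s → s ≡ (a + s) - a
step-as-difference = solve-∀

rise-difference : ∀ a → (1ℤ + a) - a ≡ 1ℤ
rise-difference = solve-∀

fall-difference : ∀ a → a - (1ℤ + a) ≡ -1ℤ
fall-difference = solve-∀

risingDirection : ∀ d x → netLen d (suc x) ≡ sucℤ (netLen d x) → d x ≡ true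
risingDirection d x rise = forward (d x) (begin
  step (d x)                           ≡⟨ step-as-difference (netLen d x) (step (d x)) ⟩
  netLen d (suc x) - netLen d x        ≡⟨ cong (_- netLen d x) rise ⟩
  sucℤ (netLen d x) - netLen d x       ≡⟨ rise-difference (netLen d x) ⟩
  1ℤ                                   ∎)
  where
  open ≡-Reasoning
  forward : ∀ b → step b ≡ 1ℤ → b ≡ true
  forward true _ = refl

fallingDirection : ∀ d x → netLen d x ≡ sucℤ (netLen d (suc x)) → d x ≡ false
fallingDirection d x fall = backward (d x) (begin
  step (d x)                           ≡⟨ step-as-difference (netLen d x) (step (d x)) ⟩
  netLen d (suc x) - netLen d x        ≡⟨ cong (λ y → netLen d (suc x) - y) fall ⟩
  netLen d (suc x) - sucℤ (netLen d (suc x)) ≡⟨ fall-difference (netLen d (suc x)) ⟩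
  -1ℤ                                  ∎)
  where
  open ≡-Reasoning
  backward : ∀ b → step b ≡ -1ℤ → b ≡ false
  backward false _ = refl

netLen-unitStep : ∀ d x →
  netLen d (suc x) ≡ sucℤ (netLen d x) ⊎ netLen d x ≡ sucℤ (netLen d (suc x))
netLen-unitStep d x with d x
... | true  = inj₁ (ℤP.+-comm (netLen d x) 1ℤ)
... | false = inj₂ (unfall (netLen d x))
  where
  unfall : ∀ a → a ≡ 1ℤ + (a + -1ℤ)
  unfall = solve-∀

∣∣-adjacent : ∀ {p q} → Adjacent p q → ∣ q ∣ ≡ suc ∣ p ∣ ⊎ ∣ p ∣ ≡ suc ∣ q ∣
∣∣-adjacent {p} (inj₁ refl) = ∣suc∣ p
  where
  ∣suc∣ : ∀ p → ∣ sucℤ p ∣ ≡ suc ∣ p ∣ ⊎ ∣ p ∣ ≡ suc ∣ sucℤ p ∣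
  ∣suc∣ (+ n)            = inj₁ refl
  ∣suc∣ -[1+ zero ]  = inj₂ refl
  ∣suc∣ -[1+ suc k ] = inj₂ refl
∣∣-adjacent {q = q} (inj₂ refl) = Sum.swap (∣∣-adjacent {q} (inj₁ refl))

profile-unitSteps : ∀ d → UnitSteps (profile d)
profile-unitSteps d j = alongAbs (∣∣-adjacent {j} (inj₁ refl))
  where
  alongAbs : ∀ {x y} → y ≡ suc x ⊎ x ≡ suc y →
    netLen d y ≡ sucℤ (netLen d x) ⊎ netLen d x ≡ sucℤ (netLen d y)
  alongAbs {x} (inj₁ refl)     = netLen-unitStep d x
  alongAbs {y = y} (inj₂ refl) = Sum.swap (netLen-unitStep d y)

riseArc : ∀ d {a a'} → Adjacent a a' → Rises (profile d) a a' → WalkArc d ∣ a ∣ ∣ a' ∣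
riseArc d adj rise = arcBetween _ _ (∣∣-adjacent adj) rise
  where
  arcBetween : ∀ x y → y ≡ suc x ⊎ x ≡ suc y → netLen d y ≡ sucℤ (netLen d x) → WalkArc d x y
  arcBetween x .(suc x) (inj₁ refl) r = inj₁ (risingDirection d x r , refl)
  arcBetween .(suc y) y (inj₂ refl) r = inj₂ (fallingDirection d y r , refl)

-- Common oriented paths

PathHom : ∀ {m} → (Fin m → Bool) → (ℕ → Dir) → (Fin (suc m) → ℕ) → ℕ → ℕ → Set
PathHom {m} dirs d f x y = IsHom dirs d f × f fzero ≡ x × f (fromℕ m) ≡ y

CommonPath : (d₁ d₂ : ℕ → Dir) (x₀ y₀ x₁ y₁ : ℕ) → Set
CommonPath d₁ d₂ x₀ y₀ x₁ y₁ = Σ ℕ λ m → Σ (Fin m → Bool) λ dirs →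
  Σ (Fin (suc m) → ℕ) λ f₁ → Σ (Fin (suc m) → ℕ) λ f₂ →
  PathHom dirs d₁ f₁ x₀ x₁ × PathHom dirs d₂ f₂ y₀ y₁

Oriented : Dir → (ℕ → Dir) → ℕ → ℕ → Set
Oriented true  d x y = WalkArc d x y
Oriented false d x y = WalkArc d y x

consHom : ∀ {d m} {dirs : Fin m → Bool} {f : Fin (suc m) → ℕ} b x →
  Oriented b d x (f fzero) → IsHom dirs d f → IsHom (b Vector.∷ dirs) d (x Vector.∷ f)
consHom true  x arc hom _ _ (fzero , inj₁ (_ , refl , refl)) = arc
consHom false x arc hom _ _ (fzero , inj₂ (_ , refl , refl)) = arc
consHom true  x arc hom _ _ (fzero , inj₂ (() , _))
consHom false x arc hom _ _ (fzero , inj₁ (() , _))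
consHom b x arc hom _ _ (fsuc i , inj₁ (forward , refl , refl)) =
  hom _ _ (i , inj₁ (forward , refl , refl))
consHom b x arc hom _ _ (fsuc i , inj₂ (backward , refl , refl)) =
  hom _ _ (i , inj₂ (backward , refl , refl))

stay : ∀ d₁ d₂ x y → CommonPath d₁ d₂ x y x y
stay d₁ d₂ x y =
  0 , (λ ()) , (λ _ → x) , (λ _ → y) , (noArcs d₁ , refl , refl) , (noArcs d₂ , refl , refl)
  where
  noArcs : ∀ d {f : Fin 1 → ℕ} → IsHom {0} (λ ()) d f
  noArcs d _ _ (() , _)

prepend : ∀ d₁ d₂ {x y x' y' x₁ y₁} b → Oriented b d₁ x x' → Oriented b d₂ y y' →
  CommonPath d₁ d₂ x' y' x₁ y₁ → CommonPath d₁ d₂ x y x₁ y₁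
prepend d₁ d₂ {x} {y} b arc₁ arc₂
        (m , dirs , f₁ , f₂ , (hom₁ , refl , end₁) , (hom₂ , refl , end₂)) =
  suc m , b Vector.∷ dirs , x Vector.∷ f₁ , y Vector.∷ f₂ ,
  (consHom b x arc₁ hom₁ , refl , end₁) , (consHom b y arc₂ hom₂ , refl , end₂)

toPath : ∀ d₁ d₂ {a b a' b'} → Joint (profile d₁) (profile d₂) a b a' b' →
  CommonPath d₁ d₂ (∣ a ∣) (∣ b ∣) (∣ a' ∣) (∣ b' ∣)
toPath d₁ d₂ {a} {b} [] = stay d₁ d₂ (∣ a ∣) (∣ b ∣)
toPath d₁ d₂ ((adj₁ , adj₂ , inj₁ (rise₁ , rise₂)) ∷ rest) =
  prepend d₁ d₂ true (riseArc d₁ adj₁ rise₁) (riseArc d₂ adj₂ rise₂) (toPath d₁ d₂ rest)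
toPath d₁ d₂ ((adj₁ , adj₂ , inj₂ (rise₁ , rise₂)) ∷ rest) =
  prepend d₁ d₂ false (riseArc d₁ (adjacent-sym adj₁) rise₁) (riseArc d₂ (adjacent-sym adj₂) rise₂)
    (toPath d₁ d₂ rest)

netLen-≤ : ∀ d j → netLen d j ≤ + j
netLen-≤ d zero    = ℤP.≤-refl
netLen-≤ d (suc j) = subst (netLen d (suc j) ≤_) (cong +_ (ℕP.+-comm j 1))
                           (ℤP.+-mono-≤ (netLen-≤ d j) (step≤1 (d j)))
  where
  step≤1 : ∀ b → step b ≤ + 1
  step≤1 true  = ℤP.≤-refl
  step≤1 false = -≤+

netLen-shift : ∀ d k t → netLen d (t ℕ.+ k) ≡ netLen d k + netLen (shift k d) t
netLen-shift d k zero    = sym (ℤP.+-identityʳ _)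
netLen-shift d k (suc t) = trans
  (cong₂ _+_ (netLen-shift d k t) (cong (step ∘ d) (ℕP.+-comm t k)))
  (ℤP.+-assoc (netLen d k) (netLen (shift k d) t) (step (d (k ℕ.+ t))))

constrictedFrom : ∀ {d k} → ConstrictedBelow (shift k d) → ∀ s → k ℕ.≤ s → netLen d k ≤ netLen d s
constrictedFrom {d} {k} constricted s k≤s = begin
  netLen d k                          ≡⟨ ℤP.+-identityʳ _ ⟨
  netLen d k + 0ℤ                     ≤⟨ ℤP.+-monoʳ-≤ (netLen d k) (constricted t) ⟩
  netLen d k + netLen (shift k d) t   ≡⟨ netLen-shift d k t ⟨
  netLen d (t ℕ.+ k)                  ≡⟨ cong (netLen d) (ℕP.m∸n+n≡m k≤s) ⟩
  netLen d s                          ∎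
  where
  open ℤP.≤-Reasoning
  t = s ℕ.∸ k

climbToLevel : ∀ {d} → InfiniteHeight d → ConstrictedBelow d →
  ∀ M → Σ ℕ λ N → Climb (profile d) 0ℤ (+ M) N
climbToLevel {d} infinite constricted M with infinite M
... | p , M≤∣height∣ with firstClimb (profile-unitSteps d) ascent (+≤+ z≤n) ℤP.≤-refl
  where
  ascent : Ascent (profile d) 0ℤ (+ M) p
  ascent = record
    { start = refl
    ; above = λ t _ → constricted t
    ; top   = subst (+ M ≤_) (ℤP.0≤i⇒+∣i∣≡i (constricted p)) (+≤+ M≤∣height∣)
    }
...   | N , _ , climb = N , climb

walkClimbs : ∀ {d} → InfiniteHeight d → ConstrictedBelow d →
  ∀ k → ConstrictedBelow (shift k d) → ∀ M → k ℕ.< M →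
  Σ ℕ λ N → k ℕ.≤ N × Climb (profile d) 0ℤ (+ M) N
          × Climb (shiftBy k (profile d)) (netLen d k) (+ M) (N ℕ.∸ k)
walkClimbs {d} infinite constricted k constrictedAfterK M k<M
  with climbToLevel infinite constricted M
... | N , climb =
  N , k≤N , climb , climbSuffix climb k≤N refl λ s k≤s _ → constrictedFrom constrictedAfterK s k≤s
  where
  k≤N : k ℕ.≤ N
  k≤N = ℕP.<⇒≤ (ℕP.<-≤-trans k<M (ℤP.drop‿+≤+ (subst (_≤ + N) (end climb) (netLen-≤ d N))))

-- Two walks as in the corollary admit a joint walk of their profiles from (0 , 0)
-- to (k₁ , k₂): both pairs are joined to the first visits of a level M above k₁, k₂.
jointWalk : ∀ {d₁ d₂} → InfiniteHeight d₁ → ConstrictedBelow d₁ →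
  InfiniteHeight d₂ → ConstrictedBelow d₂ →
  ∀ {k₁ k₂} → ConstrictedBelow (shift k₁ d₁) → ConstrictedBelow (shift k₂ d₂) →
  netLen d₁ k₁ ≡ netLen d₂ k₂ → ∀ M → k₁ ℕ.< M → k₂ ℕ.< M →
  Joint (profile d₁) (profile d₂) 0ℤ 0ℤ (+ k₁) (+ k₂)
jointWalk {d₁} {d₂} infinite₁ constricted₁ infinite₂ constricted₂ {k₁} {k₂}
          after₁ after₂ sameHeight M k₁<M k₂<M
  with walkClimbs infinite₁ constricted₁ k₁ after₁ M k₁<M
     | walkClimbs infinite₂ constricted₂ k₂ after₂ M k₂<M
... | N₁ , k₁≤N₁ , fromStart₁ , fromK₁ | N₂ , k₂≤N₂ , fromStart₂ , fromK₂ =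
  startsToPeaks ++ reverse ksToPeaks
  where
  steps₁ = profile-unitSteps d₁
  steps₂ = profile-unitSteps d₂
  startsToPeaks : Joint (profile d₁) (profile d₂) 0ℤ 0ℤ (+ N₁) (+ N₂)
  startsToPeaks = mountainClimb M steps₁ steps₂ ℤP.≤-refl fromStart₁ fromStart₂
  ksToPeaks : Joint (profile d₁) (profile d₂) (+ k₁) (+ k₂) (+ N₁) (+ N₂)
  ksToPeaks = unshift k₁≤N₁ k₂≤N₂
    (mountainClimb M (unitSteps-∘ steps₁ (translation _)) (unitSteps-∘ steps₂ (translation _))
       (ℤP.+-monoˡ-≤ (+ M) (constricted₁ k₁)) fromK₁
       (subst (λ L → Climb _ L (+ M) _) (sym sameHeight) fromK₂))

corollary21 : {a b : Level} (H : Digraph a b) (P₁ P₂ : Walk H) →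
    InfiniteHeight (Walk.dir P₁) → ConstrictedBelow (Walk.dir P₁) →
    InfiniteHeight (Walk.dir P₂) → ConstrictedBelow (Walk.dir P₂) →
    (k₁ k₂ : ℕ) →
    ConstrictedBelow (shift k₁ (Walk.dir P₁)) →
    ConstrictedBelow (shift k₂ (Walk.dir P₂)) →
    netLen (Walk.dir P₁) k₁ ≡ netLen (Walk.dir P₂) k₂ →
    Σ ℕ λ m → Σ (Fin m → Bool) λ dirs →
      Σ (Fin (suc m) → ℕ) λ f₁ → Σ (Fin (suc m) → ℕ) λ f₂ →
        (IsHom dirs (Walk.dir P₁) f₁ × f₁ fzero ≡ 0 × f₁ (fromℕ m) ≡ k₁)
        × (IsHom dirs (Walk.dir P₂) f₂ × f₂ fzero ≡ 0 × f₂ (fromℕ m) ≡ k₂)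
corollary21 H P₁ P₂ infinite₁ constricted₁ infinite₂ constricted₂ k₁ k₂ after₁ after₂ sameHeight =
  toPath (Walk.dir P₁) (Walk.dir P₂)
    (jointWalk infinite₁ constricted₁ infinite₂ constricted₂ after₁ after₂ sameHeight
               (suc (k₁ ℕ.+ k₂)) (s≤s (ℕP.m≤m+n k₁ k₂)) (s≤s (ℕP.m≤n+m k₂ k₁)))
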